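{- There is a constant $d$ such that for every RPN $\mathcal N$ and every $t\in T_{ret}$, every shortest returning sequence $\sigma_t$ of $t$ satisfies $|\sigma_t|\le 2^{2^{dn\log n}}$, where $n$ is the size of $\mathcal N$.
   Context: A Recursive Petri Net (RPN) is a tuple $\mathcal N=\langle P,T,W^+,W^-,\Omega\rangle$ where $P$ is a finite set of places, $T=T_{el}\uplus T_{ab}\uplus T_{\tau}$ is a finite set of transitions disjoint from $P$ (elementary, abstract and cut transitions), $W^-\in\mathbb N^{P\times T}$, $W^+\in\mathbb N^{P\times(T_{el}\uplus T_{ab})}$, and $\Omega:T_{ab}\to\mathbb N^P$. Write $W^{\pm}(t)\in\mathbb N^P$ for the column of $t$; markings are compared componentwise. A (concrete) state is either the empty tree $\emptyset$ or a finite rooted tree whose vertices (threads) are taken from a fixed countably infinite set $\mathcal V$, each vertex $v$ labelled by a marking $M_s(v)\in\mathbb N^P$ and each edge labelled by a vector in $\{W^+(t):t\in T_{ab}\}$. Firing rule: a thread $v$ of a state $s\neq\emptyset$ can fire $t$ if $W^-(t)\le M_s(v)$, giving $s\xrightarrow{(v,t)}s'$ where: if $t\in T_{el}$, the marking of $v$ becomes $M_s(v)-W^-(t)+W^+(t)$; if $t\in T_{ab}$, the marking of $v$ becomes $M_s(v)-W^-(t)$ and a new child $w$ of $v$ (a vertex never used before) is created with marking $\Omega(t)$ and edge $v\to w$ labelled $W^+(t)$; if $t\in T_\tau$, the subtree rooted at $v$ is deleted, and if $v$ is the root the result is $\emptyset$, otherwise the marking of the parent $u$ of $v$ is increased by the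 label of the edge $u\to v$. For $m\in\mathbb N^P$, $s[r,m]$ denotes the state consisting of a single vertex $r$ with marking $m$. The set of returning transitions is $T_{ret}=\{t\in T_{ab}\mid \text{there is a finite firing sequence } s[r,\Omega(t)]\xrightarrow{\sigma}\emptyset\}$; for $t\in T_{ret}$, a shortest returning sequence $\sigma_t$ is a firing sequence $s[r,\Omega(t)]\xrightarrow{\sigma_t}\emptyset$ of minimal length. The size of $\mathcal N$ is the size of its encoding. -}

module Defs where

open import Data.Nat using (ℕ; zero; suc; _+_; _*_; _∸_; _^_; _≤_)
open import Data.Nat.Logarithm using (⌊log₂_⌋; ⌈log₂_⌉)
open import Data.Fin using (Fin; zero; suc)
open import Data.Sum using (_⊎_; inj₁; inj₂)
open import Data.Product using (_×_; _,_)
open import Data.List using (List; []; _∷_; _++_; [_])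
open import Data.Maybe using (Maybe; just; nothing)

Marking : ℕ → Set
Marking np = Fin np → ℕ

_≤ᴹ_ : ∀ {np} → Marking np → Marking np → Set
M ≤ᴹ M' = ∀ p → M p ≤ M' p

_+ᴹ_ : ∀ {np} → Marking np → Marking np → Marking np
(M +ᴹ M') p = M p + M' p

_∸ᴹ_ : ∀ {np} → Marking np → Marking np → Marking np
(M ∸ᴹ M') p = M p ∸ M' p

-- A Recursive Petri Net.  Places are Fin np; transitions are
-- T = T_el ⊎ T_ab ⊎ T_τ with T_el = Fin nel, T_ab = Fin nab, T_τ = Fin ncut.
record RPN : Set where
  field
    np nel nab ncut : ℕ
    W⁻el  : Fin nel  → Marking np
    W⁻ab  : Fin nab  → Marking np
    W⁻cut : Fin ncut → Marking np
    W⁺el  : Fin nel  → Marking np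
    W⁺ab  : Fin nab  → Marking np
    Ω     : Fin nab  → Marking np

  Trans : Set
  Trans = Fin nel ⊎ (Fin nab ⊎ Fin ncut)

  W⁻ : Trans → Marking np
  W⁻ (inj₁ t) = W⁻el t
  W⁻ (inj₂ (inj₁ t)) = W⁻ab t
  W⁻ (inj₂ (inj₂ t)) = W⁻cut t

open RPN

sumFin : (n : ℕ) → (Fin n → ℕ) → ℕ
sumFin zero f = 0
sumFin (suc n) f = f zero + sumFin n (λ i → f (suc i))

bitlen : ℕ → ℕ
bitlen k = suc ⌊log₂ k ⌋

sizeM : ∀ {np} → Marking np → ℕ
sizeM {np} M = sumFin np (λ p → bitlen (M p))

size : RPN → ℕ
size N = np N + nel N + nab N + ncut N
       + sumFin (nel N)  (λ t → sizeM (W⁻el N t) + sizeM (W⁺el N t))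
       + sumFin (nab N)  (λ t → sizeM (W⁻ab N t) + sizeM (W⁺ab N t) + sizeM (Ω N t))
       + sumFin (ncut N) (λ t → sizeM (W⁻cut N t))

-- Concrete non-empty states: finite rooted trees of threads.  Each
-- node carries the marking of the thread; each child is paired with
-- the label of the edge to it.  Thread names are irrelevant for firing
-- sequences and are represented by positions in the tree.
data Tree (np : ℕ) : Set where
  node : Marking np → List (Marking np × Tree np) → Tree np

State : ℕ → Set
State np = Maybe (Tree np)

-- Result of firing at some thread of a subtree: either the subtree is
-- replaced, or the root of the subtree was cut (subtree deleted).
data Result (np : ℕ) : Set where
  stays : Tree np → Result np
  gone  : Result np

module Semantics (N : RPN) where
  open RPN N using () renaming (np to P)

  -- ChildFire cs t cs' δ : some thread inside the forest cs fires t,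
  -- yielding cs', and δ is added to the marking of the parent
  -- (δ is the edge label if a child was cut, 0 otherwise).
  data Fire : Tree P → Trans N → Result P → Set
  data ChildFire : List (Marking P × Tree P) → Trans N →
                   List (Marking P × Tree P) → Marking P → Set

  data Fire where
    fire-el  : ∀ {m cs} (t : Fin (nel N)) → W⁻el N t ≤ᴹ m →
               Fire (node m cs) (inj₁ t)
                    (stays (node ((m ∸ᴹ W⁻el N t) +ᴹ W⁺el N t) cs))
    fire-ab  : ∀ {m cs} (t : Fin (nab N)) → W⁻ab N t ≤ᴹ m →
               Fire (node m cs) (inj₂ (inj₁ t))
                    (stays (node (m ∸ᴹ W⁻ab N t)
                                 (cs ++ [ (W⁺ab N t , node (Ω N t) []) ])))
    fire-cut : ∀ {m cs} (t : Fin (ncut N)) → W⁻cut N t ≤ᴹ m →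
               Fire (node m cs) (inj₂ (inj₂ t)) gone
    fire-in  : ∀ {m cs cs' t δ} → ChildFire cs t cs' δ →
               Fire (node m cs) t (stays (node (m +ᴹ δ) cs'))

  data ChildFire where
    here-stays : ∀ {e τ τ' cs t} → Fire τ t (stays τ') →
                 ChildFire ((e , τ) ∷ cs) t ((e , τ') ∷ cs) (λ _ → 0)
    here-gone  : ∀ {e τ cs t} → Fire τ t gone →
                 ChildFire ((e , τ) ∷ cs) t cs e
    there      : ∀ {c cs cs' t δ} → ChildFire cs t cs' δ →
                 ChildFire (c ∷ cs) t (c ∷ cs') δ

  data Step : State P → State P → Set where
    step-stays : ∀ {τ τ' t} → Fire τ t (stays τ') → Step (just τ) (just τ')
    step-gone  : ∀ {τ t} → Fire τ t gone → Step (just τ) nothing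

  data Run : State P → State P → Set where
    done : ∀ {s} → Run s s
    _∷_  : ∀ {s s' s''} → Step s s' → Run s' s'' → Run s s''

  length : ∀ {s s'} → Run s s' → ℕ
  length done = 0
  length (_ ∷ σ) = suc (length σ)

  single : Marking P → State P
  single m = just (node m [])

  Returning : Fin (nab N) → Set
  Returning t = Run (single (Ω N t)) nothing

  IsReturning : Fin (nab N) → Set
  IsReturning t = Returning t

  Shortest : (t : Fin (nab N)) → Returning t → Set
  Shortest t σ = ∀ (σ' : Returning t) → length σ ≤ length σ'

module Submission where

-- Seen from the root thread, a returning sequence of t is a covering sequence, from
-- Ω(t), of the precondition of a cut transition in a vector addition system whose
-- transitions are the elementary ones together with the abstract ones whose child
-- returns faster (the child then hands back W⁺). Rackoff's bound shortens this covering
-- to a length F doubly exponential in the number of places; replaying it, each abstract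
-- transition followed by a returning sequence of its child, shows that t returns within
-- level (j + 1) = 1 + F (1 + level j) as soon as every faster returning transition
-- returns within level j. The sets of transitions returning within level j increase with
-- j, so they are stationary at some j ≤ |T_ab|; from there on every returning transition
-- returns within level |T_ab| ≤ 2 ^ 2 ^ (4 n log n).

open import Defs
open import Data.Fin using (Fin; zero; suc; toℕ; fromℕ<; inject≤; punchIn; punchOut; funToFin; finToFun)
import Data.Fin.Properties as Fin
open import Data.Fin.Subset using (⊥; ⁅_⁆; _∪_; _∈_; _⊂_; ∣_∣)
open import Data.Fin.Subset.Properties
  using (∉⊥; ∣p∣≤n; p⊂q⇒∣p∣<∣q∣; q⊆p∪q; x∈p∪q⁺; x∈p∪q⁻; x∈⁅x⁆; x∈⁅y⁆⇒x≡y)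
open import Data.List using (List; []; _∷_; _++_; [_])
open import Data.Maybe using (just; nothing)
open import Data.Nat
  using ( ℕ; zero; suc; _+_; _*_; _∸_; _^_; _≤_; _<_; z≤n; s≤s; _≤?_
        ; NonZero; >-nonZero; >-nonZero⁻¹; ⌊_/2⌋; ⌈_/2⌉)
open import Data.Nat.Induction using (<-rec; <-wellFounded)
open import Data.Nat.Logarithm using (⌈log₂_⌉; ⌊log₂_⌋; ⌊log₂⌋-mono-≤; ⌊log₂[2^n]⌋≡n)
open import Data.Nat.Logarithm.Core using (⌈log2⌉)
open import Data.Nat.Properties
open import Algebra.Properties.CommutativeSemigroup +-commutativeSemigroup using (xy∙z≈xz∙y; x∙yz≈y∙xz)
open import Data.Nat.Tactic.RingSolver using (solve-∀)
open import Data.Product using (Σ; ∃; ∃₂; _×_; _,_)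
open import Data.Sum using (_⊎_; inj₁; inj₂)
open import Effect.Monad using (RawMonad)
open import Induction.WellFounded using (Acc; acc)
open import Level using (0ℓ)
open import Relation.Binary.PropositionalEquality
  using (_≡_; refl; sym; trans; cong; subst; subst₂; module ≡-Reasoning)
open import Relation.Nullary using (¬_; Dec; yes; no; contradiction)
open import Relation.Nullary.Decidable using (_×-dec_; ¬¬-excluded-middle; decidable-stable)
open import Relation.Nullary.Negation using (DoubleNegation; ¬¬-Monad; ¬¬-map)

-- Rackoff's bound for coverings in vector addition systems

data Covering {k : ℕ} {T : Set} (pre post : T → Marking k) (target : Marking k) :
               Marking k → ℕ → Set where
  covered : ∀ {m} → target ≤ᴹ m → Covering pre post target m 0
  fire    : ∀ {m n} (t : T) → pre t ≤ᴹ m →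
            Covering pre post target ((m ∸ᴹ pre t) +ᴹ post t) n →
            Covering pre post target m (suc n)

ShortCovering : ∀ {k} {T : Set} (pre post : T → Marking k) (target m : Marking k) → ℕ → Set
ShortCovering pre post target m b = ∃ λ n → n ≤ b × Covering pre post target m n

module Coverings {k : ℕ} {T : Set} (pre post : T → Marking k) (target : Marking k) where

  Cov : Marking k → ℕ → Set
  Cov = Covering pre post target

  Cov-mono : ∀ {m m' n} → m ≤ᴹ m' → Cov m n → Cov m' n
  Cov-mono m≤m' (covered tgt≤m) = covered (λ p → ≤-trans (tgt≤m p) (m≤m' p))
  Cov-mono m≤m' (fire t pre≤m c) =
    fire t (λ p → ≤-trans (pre≤m p) (m≤m' p))
      (Cov-mono (λ p → +-monoˡ-≤ (post t p) (∸-monoˡ-≤ (pre t p) (m≤m' p))) c)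

  marking : ∀ {m n} → Cov m n → Fin (suc n) → Marking k
  marking {m} c            zero    = m
  marking (fire t pre≤m c) (suc i) = marking c i

  suffix : ∀ {m n} (c : Cov m n) (i : Fin (suc n)) → Cov (marking c i) (n ∸ toℕ i)
  suffix c                zero    = c
  suffix (fire t pre≤m c) (suc i) = suffix c i

  replaceSuffix : ∀ {m n n'} (c : Cov m n) (i : Fin (suc n)) →
                  Cov (marking c i) n' → Cov m (toℕ i + n')
  replaceSuffix c                zero    c' = c'
  replaceSuffix (fire t pre≤m c) (suc i) c' = fire t pre≤m (replaceSuffix c i c')

  removeLoop : ∀ {m n} (c : Cov m n) (i j : Fin (suc n)) → toℕ i < toℕ j →
               marking c j ≤ᴹ marking c i → ∃ λ n' → n' < n × Cov m n'
  removeLoop {n = n} c i j i<j loop =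
    toℕ i + (n ∸ toℕ j) ,
    subst (toℕ i + (n ∸ toℕ j) <_) (m+[n∸m]≡n (Fin.toℕ≤pred[n] j)) (+-monoˡ-< (n ∸ toℕ j) i<j) ,
    replaceSuffix c i (Cov-mono loop (suffix c j))

  -- Markings below R take at most R ^ k values, so among the first R ^ k + 1 of them
  -- two coincide and the loop between them can be cut out.
  shortenSmallPrefix : ∀ R {m n} (c : Cov m n) → R ^ k ≤ n →
                       (∀ i → toℕ i ≤ R ^ k → ∀ p → marking c i p < R) →
                       ∃ λ n' → n' < n × Cov m n'
  shortenSmallPrefix R {m} {n} c Rᵏ≤n small = cutLoop (Fin.pigeonhole ≤-refl code)
    where
    ι : Fin (suc (R ^ k)) → Fin (suc n)
    ι i = inject≤ i (s≤s Rᵏ≤n)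
    toℕ-ι : ∀ i → toℕ (ι i) ≡ toℕ i
    toℕ-ι i = Fin.toℕ-inject≤ i (s≤s Rᵏ≤n)
    small-ι : ∀ i p → marking c (ι i) p < R
    small-ι i = small (ι i) (subst (_≤ R ^ k) (sym (toℕ-ι i)) (Fin.toℕ≤pred[n] i))
    code : Fin (suc (R ^ k)) → Fin (R ^ k)
    code i = funToFin (λ p → fromℕ< (small-ι i p))
    decode : ∀ i j → code i ≡ code j → ∀ p → marking c (ι i) p ≡ marking c (ι j) p
    decode i j same p = begin
      marking c (ι i) p                                 ≡⟨ Fin.toℕ-fromℕ< (small-ι i p) ⟨
      toℕ (fromℕ< (small-ι i p))                        ≡⟨ cong toℕ (Fin.finToFun-funToFin _ p) ⟨
      toℕ (finToFun (code i) p)                         ≡⟨ cong (λ x → toℕ (finToFun x p)) same ⟩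
      toℕ (finToFun (code j) p)                         ≡⟨ cong toℕ (Fin.finToFun-funToFin _ p) ⟩
      toℕ (fromℕ< (small-ι j p))                        ≡⟨ Fin.toℕ-fromℕ< (small-ι j p) ⟩
      marking c (ι j) p                                 ∎
      where open ≡-Reasoning
    cutLoop : (∃₂ λ i j → toℕ i < toℕ j × code i ≡ code j) → ∃ λ n' → n' < n × Cov m n'
    cutLoop (i , j , i<j , same) =
      removeLoop c (ι i) (ι j) (subst₂ _<_ (sym (toℕ-ι i)) (sym (toℕ-ι j)) i<j)
        (λ p → ≤-reflexive (sym (decode i j same p)))

module Projection {k : ℕ} (j : Fin (suc k)) where

  project : Marking (suc k) → Marking k
  project m q = m (punchIn j q)

  project-covering : ∀ {T : Set} {pre post : T → Marking (suc k)} {target m n} →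
                     Covering pre post target m n →
                     Covering (λ t → project (pre t)) (λ t → project (post t)) (project target) (project m) n
  project-covering (covered tgt≤m)    = covered (λ q → tgt≤m (punchIn j q))
  project-covering (fire t pre≤m c) = fire t (λ q → pre≤m (punchIn j q)) (project-covering c)

  ≤ᴹ-unproject : ∀ {a b : Marking (suc k)} → project a ≤ᴹ project b → a j ≤ b j → a ≤ᴹ b
  ≤ᴹ-unproject {a} {b} a≤b aⱼ≤bⱼ p with j Fin.≟ p
  ... | yes refl = aⱼ≤bⱼ
  ... | no  j≢p  = subst (λ p → a p ≤ b p) (Fin.punchIn-punchOut j≢p) (a≤b (punchOut j≢p))

  -- Each step removes at most W tokens from place j, so starting with W * (n + 1)
  -- tokens there, place j never blocks a covering of length n.
  unproject-covering : ∀ {T : Set} {pre post : T → Marking (suc k)} {target} W →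
                       (∀ t → pre t j ≤ W) → target j ≤ W →
                       ∀ {m n} → Covering (λ t → project (pre t)) (λ t → project (post t))
                                          (project target) (project m) n →
                       W * suc n ≤ m j → Covering pre post target m n
  unproject-covering W pre≤W target≤W (covered tgt≤m) enough =
    covered (≤ᴹ-unproject tgt≤m (≤-trans target≤W (≤-trans (m≤m*n W 1) enough)))
  unproject-covering {pre = pre} {post} W pre≤W target≤W {m} {suc n} (fire t pre≤m c) enough =
    fire t (≤ᴹ-unproject pre≤m (≤-trans (pre≤W t) (≤-trans (m≤m*n W (suc (suc n))) enough)))
      (unproject-covering W pre≤W target≤W c (begin
        W * suc n                 ≤⟨ m+n≤o⇒m≤o∸n (W * suc n) (subst (_≤ m j) W*[2+n]≡ enough) ⟩
        m j ∸ W                   ≤⟨ ∸-monoʳ-≤ (m j) (pre≤W t) ⟩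
        m j ∸ pre t j             ≤⟨ m≤m+n _ (post t j) ⟩
        m j ∸ pre t j + post t j  ∎))
    where
    open ≤-Reasoning
    W*[2+n]≡ : W * suc (suc n) ≡ W * suc n + W
    W*[2+n]≡ = trans (*-suc W (suc n)) (+-comm W _)

module Rackoff (W : ℕ) where

  rackoffBound : ℕ → ℕ
  rackoffBound zero    = 0
  rackoffBound (suc k) = (W * suc (rackoffBound k)) ^ suc k + rackoffBound k

  -- Rackoff's argument, by induction on the dimension: a covering that stays below
  -- R := W * (1 + rackoffBound k) in every coordinate for R ^ (k + 1) steps has a loop;
  -- once some coordinate reaches R it can be ignored and the rest covered in dimension k.
  shortCovering : ∀ k {T : Set} (pre post : T → Marking k) (target : Marking k) →
                  (∀ t p → pre t p ≤ W) → (∀ p → target p ≤ W) →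
                  ∀ {m n} → Covering pre post target m n →
                  ShortCovering pre post target m (rackoffBound k)
  shortCovering zero    pre post target _ _ _ = 0 , z≤n , covered (λ ())
  shortCovering (suc k) pre post target pre≤W target≤W {n = n} = <-rec Shortenable shorten n
    where
    open Coverings pre post target
    b = rackoffBound k
    R = W * suc b

    Shortenable : ℕ → Set
    Shortenable n = ∀ {m} → Cov m n → ShortCovering pre post target m (R ^ suc k + b)

    fromLarge : ∀ {m n} j → R ≤ m j → Cov m n → ShortCovering pre post target m b
    fromLarge j R≤mⱼ c
      with n' , n'≤b , c' ← shortCovering k _ _ _ (λ t q → pre≤W t _) (λ q → target≤W _)
                              (Projection.project-covering j c)
      = n' , n'≤b , Projection.unproject-covering j W (λ t → pre≤W t j) (target≤W j) c'
                      (≤-trans (*-monoʳ-≤ W (s≤s n'≤b)) R≤mⱼ)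

    shorten : ∀ n → (∀ {n'} → n' < n → Shortenable n') → Shortenable n
    shorten n rec c with n ≤? R ^ suc k
    ... | yes short = n , m≤n⇒m≤n+o b short , c
    ... | no  long
      with Fin.any? (λ i → (toℕ i ≤? R ^ suc k) ×-dec Fin.any? (λ p → R ≤? marking c i p))
    ...   | yes (i , i≤Rᵏ , p , large)
      with n' , n'≤b , c' ← fromLarge p large (suffix c i)
      = toℕ i + n' , +-mono-≤ i≤Rᵏ n'≤b , replaceSuffix c i c'
    ...   | no  allSmall
      with n' , n'<n , c' ← shortenSmallPrefix R c (<⇒≤ (≰⇒> long))
                              (λ i i≤Rᵏ p → ≰⇒> (λ large → allSmall (i , i≤Rᵏ , p , large)))
      = rec n'<n c'

rackoffExponent≤ : ∀ {s A Y k} → 1 ≤ s → 2 * s ≤ A → suc s ≤ Y → k ≤ s →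
                   suc ((s + Y) * k) ≤ A * Y
rackoffExponent≤ {s} {A} {Y} {k} 1≤s 2s≤A 1+s≤Y k≤s = begin
  suc ((s + Y) * k)       ≤⟨ s≤s (*-monoʳ-≤ (s + Y) k≤s) ⟩
  suc ((s + Y) * s)       ≡⟨ cong suc (expand s Y) ⟩
  suc (s * s) + s * Y     ≤⟨ +-monoˡ-≤ (s * Y) (+-monoˡ-≤ (s * s) 1≤s) ⟩
  s + s * s + s * Y       ≡⟨ cong (_+ s * Y) (*-suc s s) ⟨
  s * suc s + s * Y       ≤⟨ +-monoˡ-≤ (s * Y) (*-monoʳ-≤ s 1+s≤Y) ⟩
  s * Y + s * Y           ≡⟨ double s Y ⟩
  2 * s * Y               ≤⟨ *-monoˡ-≤ Y 2s≤A ⟩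
  A * Y                   ∎
  where
  open ≤-Reasoning
  expand : ∀ s Y → (s + Y) * s ≡ s * s + s * Y
  expand = solve-∀
  double : ∀ s Y → s * Y + s * Y ≡ 2 * s * Y
  double = solve-∀

rackoffBound≤ : ∀ {s} A → 1 ≤ s → 2 * s ≤ A →
                ∀ k → k ≤ s → suc (Rackoff.rackoffBound (2 ^ s) k) ≤ 2 ^ (A ^ suc k)
rackoffBound≤ {s} A 1≤s 2s≤A zero    _     = m^n>0 2 (A ^ 1)
rackoffBound≤ {s} A 1≤s 2s≤A (suc k) 1+k≤s = begin
  suc ((2 ^ s * X) ^ suc k + F k)                ≡⟨ +-suc _ (F k) ⟨
  (2 ^ s * X) ^ suc k + X                        ≤⟨ +-mono-≤ (^-monoˡ-≤ (suc k) (*-monoʳ-≤ (2 ^ s) ih)) ih ⟩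
  (2 ^ s * 2 ^ Y) ^ suc k + 2 ^ Y                ≡⟨ cong (λ x → x ^ suc k + 2 ^ Y) (^-distribˡ-+-* 2 s Y) ⟨
  (2 ^ (s + Y)) ^ suc k + 2 ^ Y                  ≡⟨ cong (_+ 2 ^ Y) (^-*-assoc 2 (s + Y) (suc k)) ⟩
  2 ^ ((s + Y) * suc k) + 2 ^ Y                  ≤⟨ +-monoʳ-≤ _ (^-monoʳ-≤ 2 Y≤e) ⟩
  2 ^ ((s + Y) * suc k) + 2 ^ ((s + Y) * suc k)  ≡⟨ cong (2 ^ ((s + Y) * suc k) +_) (+-identityʳ _) ⟨
  2 ^ suc ((s + Y) * suc k)                      ≤⟨ ^-monoʳ-≤ 2 (rackoffExponent≤ 1≤s 2s≤A 1+s≤Y 1+k≤s) ⟩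
  2 ^ (A * Y)                                    ∎
  where
  open ≤-Reasoning
  F = Rackoff.rackoffBound (2 ^ s)
  X = suc (F k)
  Y = A ^ suc k
  ih : X ≤ 2 ^ Y
  ih = rackoffBound≤ A 1≤s 2s≤A k (≤-trans (n≤1+n k) 1+k≤s)
  instance
    A≢0 : NonZero A
    A≢0 = >-nonZero (≤-trans (≤-trans 1≤s (m≤m+n s (s + 0))) 2s≤A)
  1+s≤Y : suc s ≤ Y
  1+s≤Y = begin
    suc s     ≤⟨ +-monoˡ-≤ s 1≤s ⟩
    s + s     ≡⟨ cong (s +_) (+-identityʳ s) ⟨
    2 * s     ≤⟨ 2s≤A ⟩
    A         ≡⟨ ^-identityʳ A ⟨
    A ^ 1     ≤⟨ ^-monoʳ-≤ A {1} {suc k} (s≤s z≤n) ⟩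
    Y         ∎
  Y≤e : Y ≤ (s + Y) * suc k
  Y≤e = ≤-trans (m≤n+m Y s) (m≤m*n (s + Y) (suc k))

-- Increasing chains of predicates on a finite set

open RawMonad (¬¬-Monad {a = 0ℓ}) using (return; _>>=_)

¬¬-∀-Fin : ∀ {n} {Q : Fin n → Set} → (∀ i → DoubleNegation (Q i)) → DoubleNegation (∀ i → Q i)
¬¬-∀-Fin {zero}  _ = return λ ()
¬¬-∀-Fin {suc n} q = do
  q₀ ← q zero
  qₛ ← ¬¬-∀-Fin (λ i → q (suc i))
  return λ { zero → q₀ ; (suc i) → qₛ i }

Stationary : ∀ {n} → (ℕ → Fin n → Set) → ℕ → Set
Stationary P j = ∀ a → P (suc j) a → P j a

module _ {n : ℕ} (P : ℕ → Fin n → Set) (P-mono : ∀ {j a} → P j a → P (suc j) a) where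

  stationary⊎grows : ∀ j → DoubleNegation (Stationary P j ⊎ ∃ λ a → P (suc j) a × ¬ P j a)
  stationary⊎grows j = do
    P? ← ¬¬-∀-Fin (λ a → ¬¬-excluded-middle)
    no noGrowth ← ¬¬-excluded-middle
      where yes growth → return (inj₂ growth)
    return (inj₁ λ a Pₛa → decided a Pₛa (P? a) noGrowth)
    where
    decided : ∀ a → P (suc j) a → Dec (P j a) → ¬ (∃ λ a → P (suc j) a × ¬ P j a) → P j a
    decided a Pₛa (yes Pa) _        = Pa
    decided a Pₛa (no ¬Pa) noGrowth = contradiction (a , Pₛa , ¬Pa) noGrowth

  stationary⊎large : ∀ j → DoubleNegation ((∃ λ i → i < j × Stationary P i) ⊎
                                           (∃ λ X → j ≤ ∣ X ∣ × ∀ a → a ∈ X → P j a))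
  stationary⊎large zero    = return (inj₂ (⊥ , z≤n , λ a a∈⊥ → contradiction a∈⊥ ∉⊥))
  stationary⊎large (suc j) = do
    inj₂ (X , j≤∣X∣ , X⊆Pⱼ) ← stationary⊎large j
      where inj₁ (i , i<j , st) → return (inj₁ (i , m<n⇒m<1+n i<j , st))
    inj₂ (a , Pₛa , ¬Pⱼa) ← stationary⊎grows j
      where inj₁ st → return (inj₁ (j , n<1+n j , st))
    let a∉X : ¬ (a ∈ X)
        a∉X a∈X = ¬Pⱼa (X⊆Pⱼ a a∈X)
        X⊂X+a : X ⊂ ⁅ a ⁆ ∪ X
        X⊂X+a = q⊆p∪q ⁅ a ⁆ X , a , x∈p∪q⁺ (inj₁ (x∈⁅x⁆ a)) , a∉X
    return (inj₂ (⁅ a ⁆ ∪ X , ≤-trans (s≤s j≤∣X∣) (p⊂q⇒∣p∣<∣q∣ X⊂X+a) , grown a Pₛa X X⊆Pⱼ))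
    where
    grown : ∀ a → P (suc j) a → ∀ X → (∀ a → a ∈ X → P j a) → ∀ b → b ∈ ⁅ a ⁆ ∪ X → P (suc j) b
    grown a Pₛa X X⊆Pⱼ b b∈ with x∈p∪q⁻ ⁅ a ⁆ X b∈
    ... | inj₁ b∈⁅a⁆ = subst (P (suc j)) (sym (x∈⁅y⁆⇒x≡y a b∈⁅a⁆)) Pₛa
    ... | inj₂ b∈X   = P-mono (X⊆Pⱼ b b∈X)

  increasingChain-stabilises : DoubleNegation (∃ λ j → j ≤ n × Stationary P j)
  increasingChain-stabilises = do
    inj₁ (j , j<1+n , st) ← stationary⊎large (suc n)
      where inj₂ (X , 1+n≤∣X∣ , _) → contradiction (≤-trans 1+n≤∣X∣ (∣p∣≤n X)) 1+n≰n
    return (j , ≤-pred j<1+n , st)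

-- Returning sequences

module ReturningRuns (N : RPN) where
  open RPN N
  open Semantics N

  Children : Set
  Children = List (Marking np × Tree np)

  0ᴹ : Marking np
  0ᴹ _ = 0

  ReturnsBefore : ℕ → Fin nab → Set
  ReturnsBefore ℓ a = Σ (Returning a) λ σ → length σ < ℓ

  ReturnsWithin : ℕ → Fin nab → Set
  ReturnsWithin ℓ a = Σ (Returning a) λ σ → length σ ≤ ℓ

  -- The vector addition system run by a single thread: its elementary transitions, and
  -- the abstract transitions a with A a, whose child is taken to return at once and
  -- hand back W⁺ab a.
  ThreadTrans : (Fin nab → Set) → Set
  ThreadTrans A = Fin nel ⊎ Σ (Fin nab) A

  pre : ∀ {A} → ThreadTrans A → Marking np
  pre (inj₁ e)       = W⁻el e
  pre (inj₂ (a , _)) = W⁻ab a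

  post : ∀ {A} → ThreadTrans A → Marking np
  post (inj₁ e)       = W⁺el e
  post (inj₂ (a , _)) = W⁺ab a

  CutCovering : (Fin nab → Set) → Fin ncut → Marking np → ℕ → Set
  CutCovering A c = Covering (pre {A}) (post {A}) (W⁻cut c)

  CutCovering-map : ∀ {A A' c m n} → (∀ {a} → A a → A' a) → CutCovering A c m n → CutCovering A' c m n
  CutCovering-map f (covered h)                = covered h
  CutCovering-map f (fire (inj₁ e) h c)       = fire (inj₁ e) h (CutCovering-map f c)
  CutCovering-map f (fire (inj₂ (a , x)) h c) = fire (inj₂ (a , f x)) h (CutCovering-map f c)

  CutCovering-suc : ∀ {ℓ c m n} → CutCovering (ReturnsBefore ℓ) c m n →
                    CutCovering (ReturnsBefore (suc ℓ)) c m n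
  CutCovering-suc = CutCovering-map (λ (σ , σ<ℓ) → σ , m<n⇒m<1+n σ<ℓ)

  data ReturningChildren (ℓ : ℕ) : Children → Marking np → Set where
    []      : ReturningChildren ℓ [] 0ᴹ
    skip    : ∀ {c cs S} → ReturningChildren ℓ cs S → ReturningChildren ℓ (c ∷ cs) S
    returns : ∀ {e τ cs S} (ρ : Run (just τ) nothing) → length ρ < ℓ →
              ReturningChildren ℓ cs S → ReturningChildren ℓ ((e , τ) ∷ cs) (e +ᴹ S)

  noChildren : ∀ {ℓ} cs → ReturningChildren ℓ cs 0ᴹ
  noChildren []       = []
  noChildren (c ∷ cs) = skip (noChildren cs)

  ReturningChildren-suc : ∀ {ℓ cs S} → ReturningChildren ℓ cs S → ReturningChildren (suc ℓ) cs S
  ReturningChildren-suc []               = []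
  ReturningChildren-suc (skip rs)        = skip (ReturningChildren-suc rs)
  ReturningChildren-suc (returns ρ lt rs) = returns ρ (m<n⇒m<1+n lt) (ReturningChildren-suc rs)

  unsnoc : ∀ {ℓ} cs {e τ S} → ReturningChildren ℓ (cs ++ [ (e , τ) ]) S →
           ReturningChildren ℓ cs S ⊎
           (Σ (Run (just τ) nothing) (λ ρ → length ρ < ℓ) ×
            ∃ λ S₁ → ReturningChildren ℓ cs S₁ × S ≤ᴹ (S₁ +ᴹ e))
  unsnoc []            (skip [])         = inj₁ []
  unsnoc [] {e}        (returns ρ lt []) = inj₂ ((ρ , lt) , 0ᴹ , [] , λ p → ≤-reflexive (+-comm (e p) 0))
  unsnoc (c ∷ cs)      (skip rs)         with unsnoc cs rs
  ... | inj₁ rs'                      = inj₁ (skip rs')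
  ... | inj₂ (r , S₁ , rs' , S≤)      = inj₂ (r , S₁ , skip rs' , S≤)
  unsnoc ((e' , _) ∷ cs) {e} (returns ρ lt rs) with unsnoc cs rs
  ... | inj₁ rs'                      = inj₁ (returns ρ lt rs')
  ... | inj₂ (r , S₁ , rs' , S≤)      =
        inj₂ (r , e' +ᴹ S₁ , returns ρ lt rs' ,
              λ p → ≤-trans (+-monoʳ-≤ (e' p) (S≤ p)) (≤-reflexive (sym (+-assoc (e' p) (S₁ p) (e p)))))

  pullBack : ∀ {ℓ cs t cs' δ S'} → ChildFire cs t cs' δ → ReturningChildren ℓ cs' S' → 1 ≤ ℓ →
             ∃ λ S → ReturningChildren (suc ℓ) cs S × (δ +ᴹ S') ≤ᴹ S
  pullBack (here-stays f) (skip rs)         _ =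
    _ , skip (ReturningChildren-suc rs) , λ p → ≤-refl
  pullBack (here-stays f) (returns ρ lt rs) _ =
    _ , returns (step-stays f ∷ ρ) (s≤s lt) (ReturningChildren-suc rs) , λ p → ≤-refl
  pullBack (here-gone f)  rs             1≤ℓ =
    _ , returns (step-gone f ∷ done) (s≤s 1≤ℓ) (ReturningChildren-suc rs) , λ p → ≤-refl
  pullBack (there cf) (skip rs) 1≤ℓ with S , rs' , δ+S'≤S ← pullBack cf rs 1≤ℓ =
    S , skip rs' , δ+S'≤S
  pullBack {δ = δ} (there cf) (returns {e = e} {S = S'} ρ lt rs) 1≤ℓ
    with S , rs' , δ+S'≤S ← pullBack cf rs 1≤ℓ =
    e +ᴹ S , returns ρ (m<n⇒m<1+n lt) rs' ,
    λ p → ≤-trans (≤-reflexive (x∙yz≈y∙xz (δ p) (e p) (S' p))) (+-monoʳ-≤ (e p) (δ+S'≤S p))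

  -- A run of a thread from marking m to its own cut, seen from the thread alone:
  -- the children that return during the run hand back `returned`, and the thread's
  -- own steps form a covering of the cut transition.
  record Decomposition (ℓ : ℕ) (m : Marking np) (cs : Children) : Set where
    constructor decomposition
    field
      returned : Marking np
      children : ReturningChildren ℓ cs returned
      cut      : Fin ncut
      steps    : ℕ
      covering : CutCovering (ReturnsBefore ℓ) cut (m +ᴹ returned) steps

  decompose-el : ∀ {ℓ m cs} e → W⁻el e ≤ᴹ m → Decomposition ℓ ((m ∸ᴹ W⁻el e) +ᴹ W⁺el e) cs →
                 Decomposition (suc ℓ) m cs
  decompose-el {m = m} e pre≤m (decomposition S rs c n cov) =
    decomposition S (ReturningChildren-suc rs) c (suc n)
      (fire (inj₁ e) (λ p → ≤-trans (pre≤m p) (m≤m+n _ _))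
        (Coverings.Cov-mono pre post (W⁻cut c) (λ p → ≤-reflexive (shift p)) (CutCovering-suc cov)))
    where
    shift : ∀ p → (m p ∸ W⁻el e p + W⁺el e p) + S p ≡ (m p + S p) ∸ W⁻el e p + W⁺el e p
    shift p = trans (xy∙z≈xz∙y (m p ∸ W⁻el e p) _ _) (cong (_+ W⁺el e p) (sym (+-∸-comm (S p) (pre≤m p))))

  decompose-ab : ∀ {ℓ m cs} a → W⁻ab a ≤ᴹ m →
                 Decomposition ℓ (m ∸ᴹ W⁻ab a) (cs ++ [ (W⁺ab a , node (Ω a) []) ]) →
                 Decomposition (suc ℓ) m cs
  decompose-ab {m = m} {cs} a pre≤m (decomposition S rs c n cov) with unsnoc cs rs
  ... | inj₁ rs' =
    decomposition S (ReturningChildren-suc rs') c n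
      (Coverings.Cov-mono pre post (W⁻cut c) (λ p → +-monoˡ-≤ (S p) (m∸n≤m (m p) (W⁻ab a p)))
        (CutCovering-suc cov))
  ... | inj₂ ((σ , σ<ℓ) , S₁ , rs' , S≤S₁+e) =
    decomposition S₁ (ReturningChildren-suc rs') c (suc n)
      (fire (inj₂ (a , σ , m<n⇒m<1+n σ<ℓ)) (λ p → ≤-trans (pre≤m p) (m≤m+n _ _))
        (Coverings.Cov-mono pre post (W⁻cut c) shift (CutCovering-suc cov)))
    where
    shift : ((m ∸ᴹ W⁻ab a) +ᴹ S) ≤ᴹ (((m +ᴹ S₁) ∸ᴹ W⁻ab a) +ᴹ W⁺ab a)
    shift p = begin
      m p ∸ W⁻ab a p + S p                    ≤⟨ +-monoʳ-≤ _ (S≤S₁+e p) ⟩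
      m p ∸ W⁻ab a p + (S₁ p + W⁺ab a p)      ≡⟨ +-assoc (m p ∸ W⁻ab a p) (S₁ p) (W⁺ab a p) ⟨
      m p ∸ W⁻ab a p + S₁ p + W⁺ab a p        ≡⟨ cong (_+ W⁺ab a p) (+-∸-comm (S₁ p) (pre≤m p)) ⟨
      (m p + S₁ p) ∸ W⁻ab a p + W⁺ab a p      ∎
      where open ≤-Reasoning

  decompose-in : ∀ {ℓ m cs t cs' δ} → ChildFire cs t cs' δ → 1 ≤ ℓ →
                 Decomposition ℓ (m +ᴹ δ) cs' → Decomposition (suc ℓ) m cs
  decompose-in {m = m} {δ = δ} cf 1≤ℓ (decomposition S' rs c n cov)
    with S , rs' , δ+S'≤S ← pullBack cf rs 1≤ℓ =
    decomposition S rs' c n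
      (Coverings.Cov-mono pre post (W⁻cut c)
        (λ p → ≤-trans (≤-reflexive (+-assoc (m p) (δ p) (S' p))) (+-monoʳ-≤ (m p) (δ+S'≤S p)))
        (CutCovering-suc cov))

  length-nonEmpty : ∀ {τ} (ρ : Run (just τ) nothing) → 1 ≤ length ρ
  length-nonEmpty (_ ∷ _) = s≤s z≤n

  decompose : ∀ {m cs} (ρ : Run (just (node m cs)) nothing) → Decomposition (length ρ) m cs
  decompose {cs = cs} (step-gone (fire-cut c pre≤m) ∷ done) =
    decomposition 0ᴹ (noChildren cs) c 0 (covered (λ p → ≤-trans (pre≤m p) (m≤m+n _ 0)))
  decompose (step-gone _ ∷ (() ∷ _))
  decompose (step-stays (fire-el e pre≤m) ∷ ρ) = decompose-el e pre≤m (decompose ρ)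
  decompose (step-stays (fire-ab a pre≤m) ∷ ρ) = decompose-ab a pre≤m (decompose ρ)
  decompose (step-stays (fire-in cf)      ∷ ρ) = decompose-in cf (length-nonEmpty ρ) (decompose ρ)

  cutOf : ∀ {τ} → Run (just τ) nothing → Fin ncut
  cutOf (step-stays _ ∷ ρ)              = cutOf ρ
  cutOf (step-gone (fire-cut c _) ∷ _) = c

  _++ᴿ_ : ∀ {s s' s''} → Run s s' → Run s' s'' → Run s s''
  done    ++ᴿ ρ = ρ
  (x ∷ σ) ++ᴿ ρ = x ∷ (σ ++ᴿ ρ)

  length-++ᴿ : ∀ {s s' s''} (σ : Run s s') (ρ : Run s' s'') → length (σ ++ᴿ ρ) ≡ length σ + length ρ
  length-++ᴿ done    ρ = refl
  length-++ᴿ (x ∷ σ) ρ = cong suc (length-++ᴿ σ ρ)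

  runAsOnlyChild : ∀ {τ m e} (σ : Run (just τ) nothing) →
                   ∃ λ M → (m +ᴹ e) ≤ᴹ M ×
                   Σ (Run (just (node m [ (e , τ) ])) (single M)) λ ρ → length ρ ≡ length σ
  runAsOnlyChild {m = m} {e} (step-stays f ∷ σ)
    with M , m+e≤M , ρ , |ρ|≡|σ| ← runAsOnlyChild σ =
    M , (λ p → ≤-trans (+-monoˡ-≤ (e p) (≤-reflexive (sym (+-identityʳ (m p))))) (m+e≤M p)) ,
    step-stays (fire-in (here-stays f)) ∷ ρ , cong suc |ρ|≡|σ|
  runAsOnlyChild {m = m} {e} (step-gone f ∷ done) =
    m +ᴹ e , (λ p → ≤-refl) , step-stays (fire-in (here-gone f)) ∷ done , refl
  runAsOnlyChild (step-gone f ∷ (() ∷ _))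

  -- Each covering step becomes one step of the thread, followed, for an abstract
  -- transition, by a returning sequence of its child of length at most B.
  realise : ∀ {B c m n} → CutCovering (ReturnsWithin B) c m n → ∀ {m'} → m ≤ᴹ m' →
            Σ (Run (single m') nothing) λ ρ → length ρ ≤ suc (n * suc B)
  realise {c = c} (covered tgt≤m) m≤m' =
    step-gone (fire-cut c (λ p → ≤-trans (tgt≤m p) (m≤m' p))) ∷ done , s≤s z≤n
  realise {B} {n = suc n} (fire (inj₁ e) pre≤m cov) m≤m'
    with ρ , |ρ|≤ ← realise cov (λ p → +-monoˡ-≤ (W⁺el e p) (∸-monoˡ-≤ (W⁻el e p) (m≤m' p))) =
    step-stays (fire-el e (λ p → ≤-trans (pre≤m p) (m≤m' p))) ∷ ρ ,
    s≤s (≤-trans |ρ|≤ (s≤s (m≤n+m (n * suc B) B)))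
  realise {B} {n = suc n} (fire (inj₂ (a , σ , |σ|≤B)) pre≤m cov) {m'} m≤m'
    with M , m+e≤M , ρ₁ , |ρ₁|≡|σ| ← runAsOnlyChild {m = m' ∸ᴹ W⁻ab a} σ
    with ρ₂ , |ρ₂|≤ ← realise cov (λ p → ≤-trans (+-monoˡ-≤ (W⁺ab a p) (∸-monoˡ-≤ (W⁻ab a p) (m≤m' p)))
                                                 (m+e≤M p)) =
    step-stays (fire-ab a (λ p → ≤-trans (pre≤m p) (m≤m' p))) ∷ (ρ₁ ++ᴿ ρ₂) ,
    s≤s (begin
      length (ρ₁ ++ᴿ ρ₂)       ≡⟨ length-++ᴿ ρ₁ ρ₂ ⟩
      length ρ₁ + length ρ₂    ≡⟨ cong (_+ length ρ₂) |ρ₁|≡|σ| ⟩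
      length σ + length ρ₂     ≤⟨ +-mono-≤ |σ|≤B |ρ₂|≤ ⟩
      B + suc (n * suc B)      ≡⟨ +-suc B (n * suc B) ⟩
      suc (B + n * suc B)      ∎)
    where open ≤-Reasoning

module Levels (N : RPN) (W : ℕ) (W⁻≤W : ∀ t p → RPN.W⁻ N t p ≤ W) where
  open RPN N
  open Semantics N
  open ReturningRuns N
  open Rackoff W

  level : ℕ → ℕ
  level zero    = 0
  level (suc j) = suc (rackoffBound np * suc (level j))

  level-mono : ∀ {i j} → i ≤ j → level i ≤ level j
  level-mono z≤n       = z≤n
  level-mono (s≤s i≤j) = s≤s (*-monoʳ-≤ (rackoffBound np) (s≤s (level-mono i≤j)))

  suc-level≤ : ∀ j → suc (level j) ≤ (2 + rackoffBound np) ^ j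
  suc-level≤ zero    = ≤-refl
  suc-level≤ (suc j) = begin
    suc (suc (F * suc ℓ))              ≤⟨ s≤s (≤-trans (s≤s (m≤n+m (F * suc ℓ) ℓ)) (m≤n+m _ ℓ)) ⟩
    suc ℓ + (suc ℓ + F * suc ℓ)        ≡⟨⟩
    (2 + F) * suc ℓ                    ≤⟨ *-monoʳ-≤ (2 + F) (suc-level≤ j) ⟩
    (2 + F) * (2 + F) ^ j              ∎
    where
    open ≤-Reasoning
    F = rackoffBound np
    ℓ = level j

  ReturnsWithin-level-suc : ∀ {j a} → ReturnsWithin (level j) a → ReturnsWithin (level (suc j)) a
  ReturnsWithin-level-suc {j} (σ , |σ|≤) = σ , ≤-trans |σ|≤ (level-mono (n≤1+n j))

  pre≤W : ∀ {A} (t : ThreadTrans A) p → pre t p ≤ W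
  pre≤W (inj₁ e)       = W⁻≤W (inj₁ e)
  pre≤W (inj₂ (a , _)) = W⁻≤W (inj₂ (inj₁ a))

  nextLevel : ∀ {j a} (σ : Returning a) →
              (∀ {a'} (σ' : Returning a') → length σ' < length σ → ReturnsWithin (level j) a') →
              ReturnsWithin (level (suc j)) a
  nextLevel {j} {a} σ shorter
    with decomposition _ [] c _ cov ← decompose σ
    with n , n≤ , cov' ← shortCovering np pre post (W⁻cut c) pre≤W (W⁻≤W (inj₂ (inj₂ c)))
                           (CutCovering-map (λ (σ' , σ'<σ) → shorter σ' σ'<σ) cov)
    with ρ , |ρ|≤ ← realise cov' (λ p → ≤-reflexive (+-identityʳ (Ω a p)))
    = ρ , ≤-trans |ρ|≤ (s≤s (*-monoˡ-≤ (suc (level j)) n≤))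

  stationary⇒returnsWithin : ∀ {j} → Stationary (λ j → ReturnsWithin (level j)) j →
                             ∀ {a} (σ : Returning a) → ReturnsWithin (level j) a
  stationary⇒returnsWithin {j} stationary σ = <-rec Goal step (length σ) σ refl
    where
    Goal : ℕ → Set
    Goal ℓ = ∀ {a} (σ : Returning a) → length σ ≡ ℓ → ReturnsWithin (level j) a
    step : ∀ ℓ → (∀ {ℓ'} → ℓ' < ℓ → Goal ℓ') → Goal ℓ
    step ℓ rec σ refl = stationary _ (nextLevel σ (λ σ' σ'<σ → rec σ'<σ σ' refl))

  -- The stationary level is found classically, which is harmless because the
  -- conclusion is decidable.
  shortest≤level : ∀ {a} (σ : Returning a) → Shortest a σ → length σ ≤ level nab
  shortest≤level σ shortest =
    decidable-stable (length σ ≤? level nab)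
      (¬¬-map bound (increasingChain-stabilises (λ j → ReturnsWithin (level j)) ReturnsWithin-level-suc))
    where
    bound : (∃ λ j → j ≤ nab × Stationary (λ j → ReturnsWithin (level j)) j) → length σ ≤ level nab
    bound (j , j≤nab , stationary) with σ' , |σ'|≤ ← stationary⇒returnsWithin stationary σ =
      ≤-trans (shortest σ') (≤-trans |σ'|≤ (level-mono j≤nab))

-- Size of the net

n≤2^⌈log₂n⌉ : ∀ n → n ≤ 2 ^ ⌈log₂ n ⌉
n≤2^⌈log₂n⌉ n = go n (<-wellFounded n)
  where
  go : ∀ n (rec : Acc _<_ n) → n ≤ 2 ^ ⌈log2⌉ n rec
  go zero          _        = z≤n
  go (suc zero)    _        = s≤s z≤n
  go (suc (suc n)) (acc rs) = begin
    suc (suc n)                       ≡⟨ cong (λ x → suc (suc x)) (⌊n/2⌋+⌈n/2⌉≡n n) ⟨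
    suc (suc (⌊ n /2⌋ + h))           ≤⟨ s≤s (s≤s (+-monoˡ-≤ h (⌊n/2⌋≤⌈n/2⌉ n))) ⟩
    suc (suc (h + h))                 ≡⟨ cong suc (+-suc h h) ⟨
    suc h + suc h                     ≡⟨ cong (suc h +_) (+-identityʳ (suc h)) ⟨
    2 * suc h                         ≤⟨ *-monoʳ-≤ 2 (go (suc h) (rs (⌈n/2⌉<n n))) ⟩
    2 * 2 ^ ⌈log2⌉ (suc h) (rs (⌈n/2⌉<n n)) ∎
    where
    open ≤-Reasoning
    h = ⌈ n /2⌉

n<2^[1+⌊log₂n⌋] : ∀ n → n < 2 ^ suc ⌊log₂ n ⌋
n<2^[1+⌊log₂n⌋] n = ≰⇒> λ 2^[1+log]≤n →
  1+n≰n (subst (_≤ ⌊log₂ n ⌋) (⌊log₂[2^n]⌋≡n (suc ⌊log₂ n ⌋)) (⌊log₂⌋-mono-≤ 2^[1+log]≤n))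

f≤sumFin : ∀ n (f : Fin n → ℕ) i → f i ≤ sumFin n f
f≤sumFin (suc n) f zero    = m≤m+n _ _
f≤sumFin (suc n) f (suc i) = ≤-trans (f≤sumFin n (λ j → f (suc j)) i) (m≤n+m _ _)

entry<2^sizeM : ∀ {k} (M : Marking k) p → M p < 2 ^ sizeM M
entry<2^sizeM M p = <-≤-trans (n<2^[1+⌊log₂n⌋] (M p)) (^-monoʳ-≤ 2 (f≤sumFin _ (λ q → bitlen (M q)) p))

module SizeBounds (N : RPN) where
  open RPN N

  counts elSizes abSizes cutSizes : ℕ
  counts   = np + nel + nab + ncut
  elSizes  = sumFin nel  (λ t → sizeM (W⁻el t) + sizeM (W⁺el t))
  abSizes  = sumFin nab  (λ t → sizeM (W⁻ab t) + sizeM (W⁺ab t) + sizeM (Ω t))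
  cutSizes = sumFin ncut (λ t → sizeM (W⁻cut t))

  counts≤size : counts ≤ size N
  counts≤size = ≤-trans (m≤m+n counts elSizes) (≤-trans (m≤m+n _ abSizes) (m≤m+n _ cutSizes))

  np≤size : np ≤ size N
  np≤size = ≤-trans (≤-trans (m≤m+n np nel) (≤-trans (m≤m+n _ nab) (m≤m+n _ ncut))) counts≤size

  nab+ncut≤size : nab + ncut ≤ size N
  nab+ncut≤size = ≤-trans (+-monoˡ-≤ ncut (m≤n+m nab (np + nel))) counts≤size

  sizeM-W⁻≤size : ∀ t → sizeM (W⁻ t) ≤ size N
  sizeM-W⁻≤size (inj₁ e) =
    ≤-trans (m≤m+n _ (sizeM (W⁺el e))) (≤-trans (f≤sumFin nel _ e)
      (≤-trans (m≤n+m elSizes counts) (≤-trans (m≤m+n _ abSizes) (m≤m+n _ cutSizes))))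
  sizeM-W⁻≤size (inj₂ (inj₁ a)) =
    ≤-trans (≤-trans (m≤m+n _ (sizeM (W⁺ab a))) (m≤m+n _ (sizeM (Ω a)))) (≤-trans (f≤sumFin nab _ a)
      (≤-trans (m≤n+m abSizes (counts + elSizes)) (m≤m+n _ cutSizes)))
  sizeM-W⁻≤size (inj₂ (inj₂ c)) =
    ≤-trans (f≤sumFin ncut _ c) (m≤n+m cutSizes (counts + elSizes + abSizes))

  W⁻≤2^size : ∀ t p → W⁻ t p ≤ 2 ^ size N
  W⁻≤2^size t p = <⇒≤ (<-≤-trans (entry<2^sizeM (W⁻ t) p) (^-monoʳ-≤ 2 (sizeM-W⁻≤size t)))

exponent≤ : ∀ s l → suc (suc (suc l) * suc (suc (suc s))) + suc l ≤ 4 * suc (suc s) * suc l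
exponent≤ s l = subst (suc (suc (suc l) * suc (suc (suc s))) + suc l ≤_) (sym (expand s l)) (m≤m+n _ _)
  where
  expand : ∀ s l → 4 * suc (suc s) * suc l ≡
                   (suc (suc (suc l) * suc (suc (suc s))) + suc l) + (3 * (l * s) + 2 * s + 4 * l)
  expand = solve-∀

[2+F]^n≤2^2^[4SL] : ∀ {S L F np n} → 2 ≤ S → S ≤ 2 ^ L → np ≤ S → n ≤ S →
                    suc F ≤ 2 ^ ((2 ^ suc L) ^ suc np) → (2 + F) ^ n ≤ 2 ^ (2 ^ (4 * S * L))
[2+F]^n≤2^2^[4SL] {S} {zero} 2≤S S≤1 = contradiction (≤-trans 2≤S S≤1) λ { (s≤s ()) }
[2+F]^n≤2^2^[4SL] {suc (suc s)} {suc l} {F} {np} {n} (s≤s (s≤s _)) S≤2^L np≤S n≤S 1+F≤2^G = begin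
  (2 + F) ^ n                   ≤⟨ ^-monoˡ-≤ n 2+F≤ ⟩
  (2 ^ suc G) ^ n               ≡⟨ ^-*-assoc 2 (suc G) n ⟩
  2 ^ (suc G * n)               ≤⟨ ^-monoʳ-≤ 2 (*-mono-≤ 1+G≤ (≤-trans n≤S S≤2^L)) ⟩
  2 ^ (2 ^ suc E * 2 ^ L)       ≡⟨ cong (2 ^_) (^-distribˡ-+-* 2 (suc E) L) ⟨
  2 ^ (2 ^ (suc E + L))         ≤⟨ ^-monoʳ-≤ 2 (^-monoʳ-≤ 2 (exponent≤ s l)) ⟩
  2 ^ (2 ^ (4 * S * L))         ∎
  where
  open ≤-Reasoning
  S = suc (suc s)
  L = suc l
  G = (2 ^ suc L) ^ suc np
  E = suc L * suc S
  G≤2^E : G ≤ 2 ^ E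
  G≤2^E = ≤-trans (^-monoʳ-≤ (2 ^ suc L) {{m^n≢0 2 (suc L)}} (s≤s np≤S))
                  (≤-reflexive (^-*-assoc 2 (suc L) (suc S)))
  2+F≤ : 2 + F ≤ 2 ^ suc G
  2+F≤ = begin
    2 + F              ≤⟨ s≤s (m≤n+m (suc F) F) ⟩
    suc F + suc F      ≡⟨ cong (suc F +_) (+-identityʳ (suc F)) ⟨
    2 * suc F          ≤⟨ *-monoʳ-≤ 2 1+F≤2^G ⟩
    2 * 2 ^ G          ∎
  1+G≤ : suc G ≤ 2 ^ suc E
  1+G≤ = begin
    suc G              ≤⟨ s≤s G≤2^E ⟩
    1 + 2 ^ E          ≤⟨ +-monoˡ-≤ (2 ^ E) (m^n>0 2 E) ⟩
    2 ^ E + 2 ^ E      ≡⟨ cong (2 ^ E +_) (+-identityʳ (2 ^ E)) ⟨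
    2 * 2 ^ E          ∎

proposition5 : ∃ λ (d : ℕ) → ∀ (N : RPN) (t : Fin (RPN.nab N))
    → (σ : Semantics.Returning N t) → Semantics.Shortest N t σ
    → Semantics.length N σ ≤ 2 ^ (2 ^ (d * size N * ⌈log₂ size N ⌉))
proposition5 = 4 , shortest≤
  where
  shortest≤ : ∀ N (a : Fin (RPN.nab N)) (σ : Semantics.Returning N a) → Semantics.Shortest N a σ →
              Semantics.length N σ ≤ 2 ^ (2 ^ (4 * size N * ⌈log₂ size N ⌉))
  shortest≤ N a σ shortest = begin
    length σ                      ≤⟨ shortest≤level σ shortest ⟩
    level nab                     <⟨ suc-level≤ nab ⟩
    (2 + rackoffBound np) ^ nab   ≤⟨ [2+F]^n≤2^2^[4SL] 2≤size size≤2^L np≤size nab≤size rackoffBound≤2^G ⟩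
    2 ^ (2 ^ (4 * size N * L))    ∎
    where
    open RPN N
    open Semantics N
    open SizeBounds N
    open Levels N (2 ^ size N) W⁻≤2^size
    open Rackoff (2 ^ size N)
    open ≤-Reasoning
    L = ⌈log₂ size N ⌉
    size≤2^L = n≤2^⌈log₂n⌉ (size N)
    positive : ∀ {n} → Fin n → 1 ≤ n
    positive {n} i = >-nonZero⁻¹ n {{Fin.nonZeroIndex i}}
    2≤size : 2 ≤ size N
    2≤size = ≤-trans (+-mono-≤ (positive a) (positive (ReturningRuns.cutOf N σ))) nab+ncut≤size
    nab≤size : nab ≤ size N
    nab≤size = ≤-trans (m≤m+n nab ncut) nab+ncut≤size
    rackoffBound≤2^G : suc (rackoffBound np) ≤ 2 ^ ((2 ^ suc L) ^ suc np)
    rackoffBound≤2^G =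
      rackoffBound≤ (2 ^ suc L) (≤-trans (s≤s z≤n) 2≤size) (*-monoʳ-≤ 2 size≤2^L) np np≤size
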